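{- For a graph $G$, let $s(G)$ denote the largest integer $k$ such that $G$ has an induced $k$-star. Then $DS_{f_{\mathrm{sf}}}(G)=s(G)$.
   Context: Graphs are finite, undirected and unweighted. For an integer $k\ge1$, vertices $v_0,\dots,v_k$ form an induced $k$-star centered at $v_0$ if $(v_0,v_i)\in E(G)$ for all $i\in[k]$ and $(v_i,v_j)\notin E(G)$ for all $i,j\in[k]$. $f_{\mathrm{sf}}(G)$ is the number of edges of a spanning forest of $G$ ($=|V(G)|$ minus the number of connected components). Two graphs are node-neighbors if one is obtained from the other by deleting one vertex and its incident edges. $H\preceq H'$ means $H$ is an induced subgraph of $H'$. $DS_f(G)=\max\{|f(H')-f(H)| : H\preceq H'\preceq G,\ H,H' \text{ node-neighbors}\}$. -}

module Defs where

open import Data.Nat using (ℕ; zero; suc; _+_; _≤_; ∣_-_∣)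
open import Data.Fin using (Fin; punchIn)
open import Data.Bool using (Bool; true; false)
open import Data.Product using (Σ; _×_; _,_; ∃)
open import Relation.Binary.PropositionalEquality using (_≡_)
open import Function.Definitions using (Injective; Surjective)
open import Function.Bundles using (_↔_; Inverse)

record Graph (n : ℕ) : Set where
  field
    E     : Fin n → Fin n → Bool
    sym   : ∀ u v → E u v ≡ E v u
    irrfl : ∀ v → E v v ≡ false

open Graph public

Adj : ∀ {n} → Graph n → Fin n → Fin n → Set
Adj G u v = E G u v ≡ true

data Reach {n : ℕ} (G : Graph n) : Fin n → Fin n → Set where
  here : ∀ {v} → Reach G v v
  step : ∀ {u w v} → Adj G u w → Reach G w v → Reach G u v

NumComponents : ∀ {n} → Graph n → ℕ → Set
NumComponents {n} G c =
  Σ (Fin n → Fin c) λ comp →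
    Surjective _≡_ _≡_ comp ×
    (∀ u v → (comp u ≡ comp v → Reach G u v) × (Reach G u v → comp u ≡ comp v))

Fsf : ∀ {n} → Graph n → ℕ → Set
Fsf {n} G m = Σ ℕ λ c → NumComponents G c × (m + c ≡ n)

Iso : ∀ {m n} → Graph m → Graph n → Set
Iso {m} {n} H G =
  Σ (Fin m ↔ Fin n) λ φ → ∀ i j → E H i j ≡ E G (Inverse.to φ i) (Inverse.to φ j)

_⪯_ : ∀ {m n} → Graph m → Graph n → Set
_⪯_ {m} {n} H G =
  Σ (Fin m → Fin n) λ ι → Injective _≡_ _≡_ ι × (∀ i j → E H i j ≡ E G (ι i) (ι j))

delete : ∀ {m} → Graph (suc m) → Fin (suc m) → Graph m
delete G v = record
  { E     = λ i j → E G (punchIn v i) (punchIn v j)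
  ; sym   = λ i j → sym G (punchIn v i) (punchIn v j)
  ; irrfl = λ i → irrfl G (punchIn v i)
  }

data NodeNeighbors : ∀ {a b} → Graph a → Graph b → Set where
  del₁ : ∀ {m} (H : Graph m) (H' : Graph (suc m)) (v : Fin (suc m)) →
         Iso H (delete H' v) → NodeNeighbors H H'
  del₂ : ∀ {m} (H : Graph (suc m)) (H' : Graph m) (v : Fin (suc m)) →
         Iso H' (delete H v) → NodeNeighbors H H'

DSValue : ∀ {n} → Graph n → ℕ → Set
DSValue G d =
  Σ ℕ λ a → Σ ℕ λ b → Σ (Graph a) λ H → Σ (Graph b) λ H' →
    (H ⪯ H') × (H' ⪯ G) × NodeNeighbors H H' ×
    Σ ℕ λ x → Σ ℕ λ y → Fsf H x × Fsf H' y × (d ≡ ∣ y - x ∣)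

IsDSsf : ∀ {n} → Graph n → ℕ → Set
IsDSsf G d = DSValue G d × (∀ d' → DSValue G d' → d' ≤ d)

-- Induced k-star: centre c and k pairwise distinct leaves, all adjacent to c,
-- pairwise non-adjacent.  (k = 0 is allowed: a single vertex.)
InducedStar : ∀ {n} → Graph n → ℕ → Set
InducedStar {n} G k =
  Σ (Fin n) λ c → Σ (Fin k → Fin n) λ ℓ →
    Injective _≡_ _≡_ ℓ ×
    (∀ i → Adj G c (ℓ i)) ×
    (∀ i j → E G (ℓ i) (ℓ j) ≡ false)

IsStarNumber : ∀ {n} → Graph n → ℕ → Set
IsStarNumber G k = InducedStar G k × (∀ k' → InducedStar G k' → k' ≤ k)

{-# OPTIONS --safe #-}
module Submission where

open import Defs hiding (sym)
open import Data.Nat using (ℕ; zero; suc; _+_; _≤_; ∣_-_∣)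
open import Data.Nat.Properties
  using (+-suc; +-comm; +-assoc; +-cancelʳ-≤; +-monoʳ-≤; ≤-trans; 1+n≰n; m≤n+o⇒m∸n≤o; m≤n⇒∣n-m∣≡n∸m; ∣-∣-identityʳ; module ≤-Reasoning)
open import Data.Fin using (Fin; zero; suc; punchIn; punchOut; inject≤; _≟_)
open import Data.Fin.Properties
  using (suc-injective; punchIn-injective; punchInᵢ≢i; punchIn-punchOut; inject≤-injective; injective⇒≤)
open import Data.Bool using (Bool; false; true)
open import Data.Product using (∃; _×_; _,_; proj₁; proj₂)
open import Data.Sum using (_⊎_; inj₁; inj₂)
open import Data.Empty using (⊥-elim)
open import Relation.Nullary using (¬_; yes; no)
open import Relation.Unary using (Pred; Decidable)
open import Relation.Binary.PropositionalEquality
open import Function.Definitions using (Injective; Surjective; StrictlySurjective)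
open import Function.Base using (_∘_)
open import Function.Bundles using (Inverse)
open import Function.Construct.Identity using (↔-id)

-- If H ≅ H' - v, then f_sf(H') - f_sf(H) = c(H' - v) + 1 - c(H'), where c counts components.
-- Every component of H' contains v or a vertex of H' - v, so the difference is ≥ 0. The
-- components of H' - v that are not joined to v in H' lie in distinct components of H', all
-- different from that of v; picking a neighbour of v in each of the remaining K components of
-- H' - v gives an induced K-star centred at v, so the difference is ≤ K. Conversely, deleting
-- the centre of an induced k-star changes f_sf from k to 0.

strictlySurjective⇒≥ : ∀ {m n} {f : Fin m → Fin n} → StrictlySurjective _≡_ f → n ≤ m
strictlySurjective⇒≥ {f = f} surj = injective⇒≤ section-injective
  where
  section-injective : Injective _≡_ _≡_ (λ y → proj₁ (surj y))
  section-injective {y} {y'} eq =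
    trans (sym (proj₂ (surj y))) (trans (cong f eq) (proj₂ (surj y')))

record Partition {c} (P : Pred (Fin c) _) : Set where
  field
    inner outer    : ℕ
    inner+outer≡c  : inner + outer ≡ c
    inside         : Fin inner → Fin c
    inside-inj     : Injective _≡_ _≡_ inside
    inside-P       : ∀ i → P (inside i)
    outside        : Fin outer → Fin c
    outside-inj    : Injective _≡_ _≡_ outside
    outside-¬P     : ∀ i → ¬ P (outside i)

module _ {k c} {f : Fin k → Fin c} where

  suc∘-injective : Injective _≡_ _≡_ f → Injective _≡_ _≡_ (λ i → suc (f i))
  suc∘-injective f-inj eq = f-inj (suc-injective eq)

  zero∷suc∘ : Fin (suc k) → Fin (suc c)
  zero∷suc∘ zero    = zero
  zero∷suc∘ (suc i) = suc (f i)

  zero∷suc∘-injective : Injective _≡_ _≡_ f → Injective _≡_ _≡_ zero∷suc∘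
  zero∷suc∘-injective f-inj {zero}  {zero}  _  = refl
  zero∷suc∘-injective f-inj {suc i} {suc j} eq = cong suc (f-inj (suc-injective eq))

partition : ∀ {c} {P : Pred (Fin c) _} → Decidable P → Partition P
partition {zero} P? = record
  { inner = 0 ; outer = 0
  ; inner+outer≡c = refl
  ; inside = λ () ; inside-inj = λ {} ; inside-P = λ ()
  ; outside = λ () ; outside-inj = λ {} ; outside-¬P = λ ()
  }
partition {suc c} {P} P? with partition (λ a → P? (suc a)) | P? zero
... | p | yes P0 = record
  { inner = suc inner ; outer = outer
  ; inner+outer≡c = cong suc inner+outer≡c
  ; inside = zero∷suc∘ ; inside-inj = zero∷suc∘-injective inside-inj
  ; inside-P = λ { zero → P0 ; (suc i) → inside-P i }
  ; outside = λ i → suc (outside i) ; outside-inj = suc∘-injective outside-inj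
  ; outside-¬P = outside-¬P
  }
  where open Partition p
... | p | no ¬P0 = record
  { inner = inner ; outer = suc outer
  ; inner+outer≡c = trans (+-suc inner outer) (cong suc inner+outer≡c)
  ; inside = λ i → suc (inside i) ; inside-inj = suc∘-injective inside-inj
  ; inside-P = inside-P
  ; outside = zero∷suc∘ ; outside-inj = zero∷suc∘-injective outside-inj
  ; outside-¬P = λ { zero → ¬P0 ; (suc i) → outside-¬P i }
  }
  where open Partition p

reach-trans : ∀ {n} {G : Graph n} {u v w} → Reach G u v → Reach G v w → Reach G u w
reach-trans here       r' = r'
reach-trans (step a r) r' = step a (reach-trans r r')

reach-map : ∀ {a b} {H : Graph a} {G : Graph b} (f : Fin a → Fin b) →
  (∀ i j → E H i j ≡ E G (f i) (f j)) → ∀ {u v} → Reach H u v → Reach G (f u) (f v)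
reach-map f pres here               = here
reach-map f pres (step {u} {w} a r) = step (trans (sym (pres u w)) a) (reach-map f pres r)

adj-sym : ∀ {n} {G : Graph n} {u w} → Adj G u w → Adj G w u
adj-sym {G = G} {u} {w} a = trans (Graph.sym G w u) a

module Components {n} {G : Graph n} {c} (N : NumComponents G c) where

  component : Fin n → Fin c
  component = proj₁ N

  representative : Fin c → Fin n
  representative a = proj₁ (proj₁ (proj₂ N) a)

  component-representative : ∀ a → component (representative a) ≡ a
  component-representative a = proj₂ (proj₁ (proj₂ N) a) refl

  same⇒reach : ∀ {u w} → component u ≡ component w → Reach G u w
  same⇒reach = proj₁ (proj₂ (proj₂ N) _ _)

  reach⇒same : ∀ {u w} → Reach G u w → component u ≡ component w
  reach⇒same = proj₂ (proj₂ (proj₂ N) _ _)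

iso-numComponents : ∀ {a b} {H : Graph a} {G : Graph b} → Iso H G →
  ∀ {c} → NumComponents H c → NumComponents G c
iso-numComponents {H = H} {G} (φ , pres) {c} N =
  (λ i → component (from i)) , surjective , reach-iff
  where
  open Inverse φ
  open Components N
  pres⁻¹ : ∀ i j → E G i j ≡ E H (from i) (from j)
  pres⁻¹ i j = trans (cong₂ (E G) (sym (strictlyInverseˡ i)) (sym (strictlyInverseˡ j)))
                     (sym (pres (from i) (from j)))
  surjective : Surjective _≡_ _≡_ (λ i → component (from i))
  surjective a = to (representative a) ,
    λ eq → trans (cong component (trans (cong from eq) (strictlyInverseʳ _)))
                 (component-representative a)
  reach-iff : ∀ u v → (component (from u) ≡ component (from v) → Reach G u v)
                    × (Reach G u v → component (from u) ≡ component (from v))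
  reach-iff u v =
    (λ eq → subst₂ (Reach G) (strictlyInverseˡ u) (strictlyInverseˡ v)
              (reach-map to pres (same⇒reach eq))) ,
    (λ r → reach⇒same (reach-map from pres⁻¹ r))

iso-fsf : ∀ {a} {H G : Graph a} → Iso H G → ∀ {x} → Fsf H x → Fsf G x
iso-fsf iso (c , N , x+c≡a) = c , iso-numComponents iso N , x+c≡a

star-⪯ : ∀ {a n} {H : Graph a} {G : Graph n} {k} → H ⪯ G → InducedStar H k → InducedStar G k
star-⪯ (ι , ι-inj , pres) (c , ℓ , ℓ-inj , adj , nonadj) =
  ι c , (λ i → ι (ℓ i)) , (λ eq → ℓ-inj (ι-inj eq)) ,
  (λ i → trans (sym (pres c (ℓ i))) (adj i)) ,
  (λ i j → trans (sym (pres (ℓ i) (ℓ j))) (nonadj i j))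

star-≤ : ∀ {n} {G : Graph n} {d k} → d ≤ k → InducedStar G k → InducedStar G d
star-≤ d≤k (c , ℓ , ℓ-inj , adj , nonadj) =
  c , (λ i → ℓ (inject≤ i d≤k)) , (λ eq → inject≤-injective d≤k d≤k _ _ (ℓ-inj eq)) ,
  (λ i → adj _) , (λ i j → nonadj _ _)

starE : ∀ {k} → Fin (suc k) → Fin (suc k) → Bool
starE zero    zero    = false
starE zero    (suc _) = true
starE (suc _) zero    = true
starE (suc _) (suc _) = false

Star : ∀ k → Graph (suc k)
Star k = record { E = starE ; sym = starE-sym ; irrfl = starE-irrfl }
  where
  starE-sym : ∀ i j → starE i j ≡ starE j i
  starE-sym zero    zero    = refl
  starE-sym zero    (suc _) = refl
  starE-sym (suc _) zero    = refl
  starE-sym (suc _) (suc _) = refl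
  starE-irrfl : ∀ i → starE i i ≡ false
  starE-irrfl zero    = refl
  starE-irrfl (suc _) = refl

Edgeless : ∀ k → Graph k
Edgeless k = record { E = λ _ _ → false ; sym = λ _ _ → refl ; irrfl = λ _ → refl }

fsf-Edgeless : ∀ k → Fsf (Edgeless k) 0
fsf-Edgeless k = k , ((λ i → i) , (λ a → a , λ eq → eq) , reach-iff) , refl
  where
  reach⇒≡ : ∀ {u v} → Reach (Edgeless k) u v → u ≡ v
  reach⇒≡ here       = refl
  reach⇒≡ (step () _)
  reach-iff : ∀ u v → (u ≡ v → Reach (Edgeless k) u v) × (Reach (Edgeless k) u v → u ≡ v)
  reach-iff u v = (λ { refl → here }) , reach⇒≡

fsf-Star : ∀ k → Fsf (Star k) k
fsf-Star k = 1 , ((λ _ → zero) , (λ { zero → zero , λ _ → refl }) , reach-iff) , +-comm k 1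
  where
  to-centre : ∀ u → Reach (Star k) u zero
  to-centre zero    = here
  to-centre (suc i) = step refl here
  from-centre : ∀ u → Reach (Star k) zero u
  from-centre zero    = here
  from-centre (suc i) = step refl here
  reach-iff : ∀ u v → (zero ≡ zero → Reach (Star k) u v) × (Reach (Star k) u v → zero ≡ zero)
  reach-iff u v = (λ _ → reach-trans (to-centre u) (from-centre v)) , (λ _ → refl)

inducedStar⇒Star-⪯ : ∀ {n} {G : Graph n} {k} → InducedStar G k → Star k ⪯ G
inducedStar⇒Star-⪯ {G = G} (c , ℓ , ℓ-inj , adj , nonadj) = ι , ι-inj , pres
  where
  c≢ℓ : ∀ i → c ≢ ℓ i
  c≢ℓ i refl with trans (sym (adj i)) (irrfl G c)
  ... | ()
  ι : Fin (suc _) → Fin _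
  ι zero    = c
  ι (suc i) = ℓ i
  ι-inj : Injective _≡_ _≡_ ι
  ι-inj {zero}  {zero}  _  = refl
  ι-inj {zero}  {suc j} eq = ⊥-elim (c≢ℓ j eq)
  ι-inj {suc i} {zero}  eq = ⊥-elim (c≢ℓ i (sym eq))
  ι-inj {suc i} {suc j} eq = cong suc (ℓ-inj eq)
  pres : ∀ i j → starE i j ≡ E G (ι i) (ι j)
  pres zero    zero    = sym (irrfl G c)
  pres zero    (suc j) = sym (adj j)
  pres (suc i) zero    = sym (trans (Graph.sym G (ℓ i) c) (adj i))
  pres (suc i) (suc j) = sym (nonadj i j)

inducedStar⇒DSValue : ∀ {n} {G : Graph n} {k} → InducedStar G k → DSValue G k
inducedStar⇒DSValue {G = G} {k} star =
  k , suc k , Edgeless k , Star k ,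
  (suc , suc-injective , λ _ _ → refl) ,
  inducedStar⇒Star-⪯ {G = G} star ,
  del₁ (Edgeless k) (Star k) zero (↔-id (Fin k) , λ _ _ → refl) ,
  0 , k , fsf-Edgeless k , fsf-Star k , sym (∣-∣-identityʳ k)

y+c≡x+d⇒∣y-x∣≤k : ∀ {x y c d k} → y + c ≡ x + d → c ≤ d → d ≤ k + c → ∣ y - x ∣ ≤ k
y+c≡x+d⇒∣y-x∣≤k {x} {y} {c} {d} {k} eq c≤d d≤k+c =
  subst (_≤ k) (sym (m≤n⇒∣n-m∣≡n∸m x≤y)) (m≤n+o⇒m∸n≤o y x y≤x+k)
  where
  open ≤-Reasoning
  x≤y : x ≤ y
  x≤y = +-cancelʳ-≤ d x y (begin
    x + d  ≡⟨ sym eq ⟩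
    y + c  ≤⟨ +-monoʳ-≤ y c≤d ⟩
    y + d  ∎)
  y≤x+k : y ≤ x + k
  y≤x+k = +-cancelʳ-≤ c y (x + k) (begin
    y + c        ≡⟨ eq ⟩
    x + d        ≤⟨ +-monoʳ-≤ x d≤k+c ⟩
    x + (k + c)  ≡⟨ sym (+-assoc x k c) ⟩
    x + k + c    ∎)

module DeleteVertex {m} (G : Graph (suc m)) (v : Fin (suc m)) where

  D : Graph m
  D = delete G v

  ι : Fin m → Fin (suc m)
  ι = punchIn v

  lift-reach : ∀ {u w} → Reach D u w → Reach G (ι u) (ι w)
  lift-reach = reach-map ι (λ _ _ → refl)

  deleted-or-kept : ∀ w → w ≡ v ⊎ ∃ λ u → ι u ≡ w
  deleted-or-kept w with w ≟ v
  ... | yes w≡v = inj₁ w≡v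
  ... | no  w≢v = inj₂ (punchOut (w≢v ∘ sym) , punchIn-punchOut (w≢v ∘ sym))

  lower-walk : ∀ {s t} → Reach G s t → ∀ {u} → ι u ≡ s →
    (∃ λ u' → ι u' ≡ t × Reach D u u') ⊎ (∃ λ w → Adj G v (ι w) × Reach D u w)
  lower-walk here {u} refl = inj₁ (u , refl , here)
  lower-walk (step {w = w} a r) {u} refl with deleted-or-kept w
  ... | inj₁ refl = inj₂ (u , adj-sym {G = G} a , here)
  ... | inj₂ (u₁ , refl) with lower-walk r refl
  ...   | inj₁ (u' , ιu'≡t , r')  = inj₁ (u' , ιu'≡t , step a r')
  ...   | inj₂ (w' , vw' , r')    = inj₂ (w' , vw' , step a r')

  module _ {cD cG} (ND : NumComponents D cD) (NG : NumComponents G cG) where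

    private
      module CD = Components ND
      module CG = Components NG

    enclosing : Fin cD → Fin cG
    enclosing a = CG.component (ι (CD.representative a))

    enclosing-component : ∀ u → enclosing (CD.component u) ≡ CG.component (ι u)
    enclosing-component u =
      CG.reach⇒same (lift-reach (CD.same⇒reach (CD.component-representative (CD.component u))))

    Attached : Pred (Fin cD) _
    Attached a = enclosing a ≡ CG.component v

    attached⇒neighbour : ∀ {a} → Attached a → ∃ λ w → Adj G v (ι w) × CD.component w ≡ a
    attached⇒neighbour {a} eq with lower-walk (CG.same⇒reach eq) refl
    ... | inj₁ (u' , ιu'≡v , _) = ⊥-elim (punchInᵢ≢i v u' ιu'≡v)
    ... | inj₂ (w , vw , r)     =
      w , vw , trans (sym (CD.reach⇒same r)) (CD.component-representative a)

    enclosing-injective-on-detached : ∀ {a b} → ¬ Attached a → enclosing a ≡ enclosing b → a ≡ b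
    enclosing-injective-on-detached {a} {b} ¬att eq with lower-walk (CG.same⇒reach eq) refl
    ... | inj₁ (u' , ιu'≡ιb , r) = begin
      a                                  ≡⟨ sym (CD.component-representative a) ⟩
      CD.component (CD.representative a) ≡⟨ CD.reach⇒same r ⟩
      CD.component u'                    ≡⟨ cong CD.component (punchIn-injective v _ _ ιu'≡ιb) ⟩
      CD.component (CD.representative b) ≡⟨ CD.component-representative b ⟩
      b                                  ∎
      where open ≡-Reasoning
    ... | inj₂ (w , vw , r) =
      ⊥-elim (¬att (CG.reach⇒same (reach-trans (lift-reach r) (step (adj-sym {G = G} vw) here))))

    cG≤1+cD : cG ≤ suc cD
    cG≤1+cD = strictlySurjective⇒≥ {f = component-of} onto
      where
      component-of : Fin (suc cD) → Fin cG
      component-of zero    = CG.component v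
      component-of (suc a) = enclosing a
      onto : StrictlySurjective _≡_ component-of
      onto y with deleted-or-kept (CG.representative y)
      ... | inj₁ rep≡v =
        zero , trans (cong CG.component (sym rep≡v)) (CG.component-representative y)
      ... | inj₂ (u , ιu≡rep) = suc (CD.component u) ,
        trans (enclosing-component u) (trans (cong CG.component ιu≡rep) (CG.component-representative y))

    open Partition (partition {P = Attached} (λ a → enclosing a ≟ CG.component v))

    attached-star : InducedStar G inner
    attached-star = v , leaf , leaf-injective , leaf-adjacent , leaves-nonadjacent
      where
      neighbour : Fin inner → Fin m
      neighbour i = proj₁ (attached⇒neighbour (inside-P i))
      leaf : Fin inner → Fin (suc m)
      leaf i = ι (neighbour i)
      leaf-adjacent : ∀ i → Adj G v (leaf i)
      leaf-adjacent i = proj₁ (proj₂ (attached⇒neighbour (inside-P i)))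
      separated : ∀ {i j} → CD.component (neighbour i) ≡ CD.component (neighbour j) → i ≡ j
      separated {i} {j} eq = inside-inj (begin
        inside i                   ≡⟨ sym (proj₂ (proj₂ (attached⇒neighbour (inside-P i)))) ⟩
        CD.component (neighbour i) ≡⟨ eq ⟩
        CD.component (neighbour j) ≡⟨ proj₂ (proj₂ (attached⇒neighbour (inside-P j))) ⟩
        inside j                   ∎)
        where open ≡-Reasoning
      leaf-injective : Injective _≡_ _≡_ leaf
      leaf-injective eq = separated (cong CD.component (punchIn-injective v _ _ eq))
      leaves-nonadjacent : ∀ i j → E G (leaf i) (leaf j) ≡ false
      leaves-nonadjacent i j with E G (leaf i) (leaf j) in eq
      ... | false = refl
      ... | true with separated {i} {j} (CD.reach⇒same (step eq here))
      ...   | refl with trans (sym eq) (irrfl G (leaf i))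
      ...     | ()

    1+cD≤inner+cG : suc cD ≤ inner + cG
    1+cD≤inner+cG =
      subst (_≤ inner + cG) (trans (+-suc inner outer) (cong suc inner+outer≡c))
            (+-monoʳ-≤ inner (injective⇒≤ component-of-injective))
      where
      component-of : Fin (suc outer) → Fin cG
      component-of zero    = CG.component v
      component-of (suc i) = enclosing (outside i)
      component-of-injective : Injective _≡_ _≡_ component-of
      component-of-injective {zero}  {zero}  _  = refl
      component-of-injective {zero}  {suc j} eq = ⊥-elim (outside-¬P j (sym eq))
      component-of-injective {suc i} {zero}  eq = ⊥-elim (outside-¬P i eq)
      component-of-injective {suc i} {suc j} eq =
        cong suc (outside-inj (enclosing-injective-on-detached (outside-¬P i) eq))

  fsf-delete-bound : ∀ {x y} → Fsf D x → Fsf G y → ∃ λ k → InducedStar G k × ∣ y - x ∣ ≤ k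
  fsf-delete-bound {x} {y} (cD , ND , x+cD≡m) (cG , NG , y+cG≡1+m) =
    _ , attached-star ND NG ,
    y+c≡x+d⇒∣y-x∣≤k (trans y+cG≡1+m (sym (trans (+-suc x cD) (cong suc x+cD≡m))))
                     (cG≤1+cD ND NG) (1+cD≤inner+cG ND NG)

DSValue⇒inducedStar : ∀ {n} {G : Graph n} {d} → DSValue G d → ∃ λ k → InducedStar G k × d ≤ k
DSValue⇒inducedStar (_ , _ , _ , _ , (_ , ι-inj , _) , _ , del₂ _ _ _ _ , _) =
  ⊥-elim (1+n≰n (injective⇒≤ ι-inj))
DSValue⇒inducedStar {G = G} (_ , _ , _ , H' , _ , H'⪯G , del₁ _ _ v iso , _ , _ , fsf-H , fsf-H' , refl)
  with DeleteVertex.fsf-delete-bound H' v (iso-fsf iso fsf-H) fsf-H'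
... | k , star , bound = k , star-⪯ {H = H'} {G} H'⪯G star , bound

lemma1p7 : ∀ {n} (G : Graph n) (d : ℕ) →
    (IsDSsf G d → IsStarNumber G d) × (IsStarNumber G d → IsDSsf G d)
lemma1p7 G d =
  (λ (ds , ds-max) → let (k , star , d≤k) = DSValue⇒inducedStar {G = G} ds in
     star-≤ {G = G} d≤k star , λ k' star' → ds-max k' (inducedStar⇒DSValue {G = G} star')) ,
  (λ (star , star-max) → inducedStar⇒DSValue {G = G} star ,
     λ d' ds' → let (k , star' , d'≤k) = DSValue⇒inducedStar {G = G} ds' in
       ≤-trans d'≤k (star-max k star'))
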